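{- Let $Q$ be a cycle with a fixed orientation, let $r\ge2$ be an integer, and let $(Z_1,Z_2,Z_3)$ be a nontrivial $(Q,r)$-scheme. (b1) If $r\ge 4$, $|Z_1|+|Z_2|\ge 6$ and $|Z_3|=1$, then $|Q|\ge 2(|Z_1|+|Z_2|)+3r-12$. (b2) If $|Z_2|=|Z_3|=1$, then $|Q|\ge 2|Z_1|+3r-6$. (b3) If $|Z_1|=|Z_2|=|Z_3|=1$, then $|Q|\ge 3r$.
   Context: $|Q|$ denotes the length (number of edges) of $Q$. For vertices $x,y$ of $Q$, $x\overrightarrow{Q}y$ is the segment of $Q$ from $x$ to $y$ in the chosen direction; it is an $m$-segment if its length (number of edges) is at least $m$. Given subsets $Z_1,\dots,Z_p\subseteq V(Q)$ ($p\ge2$), the collection $(Z_1,\dots,Z_p)$ is a $(Q,r)$-scheme if $x\overrightarrow{Q}y$ is a $2$-segment for all distinct $x,y\in Z_i$ (any $i$), and is an $r$-segment for all distinct $x\in Z_i$, $y\in Z_j$ with $i\ne j$. It is nontrivial if $(Z_1,\dots,Z_p)$ has a system of distinct representatives (distinct vertices $z_1,\dots,z_p$ with $z_i\in Z_i$). -}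

module Defs where

open import Data.Nat using (ℕ; _≤_; _∸_; _+_; _≤ᵇ_)
open import Data.Bool using (if_then_else_)
open import Data.Fin using (Fin; toℕ)
open import Data.Fin.Subset using (Subset; _∈_)
open import Data.Product using (_×_; Σ)
open import Function.Definitions using (Injective)
open import Relation.Binary.PropositionalEquality using (_≡_; _≢_)

-- The cycle Q of length n has vertices Fin n, edges {i, i+1 mod n};
-- the fixed orientation goes i → i+1 (mod n).
-- segLen n x y = number of edges of the segment x Q→ y.
segLen : (n : ℕ) → Fin n → Fin n → ℕ
segLen n x y =
  if toℕ x ≤ᵇ toℕ y then toℕ y ∸ toℕ x else n ∸ (toℕ x ∸ toℕ y)

IsScheme : (n r p : ℕ) → (Fin p → Subset n) → Set
IsScheme n r p Z =
  (∀ i (x y : Fin n) → x ∈ Z i → y ∈ Z i → x ≢ y → 2 ≤ segLen n x y)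
  × (∀ (i j : Fin p) (x y : Fin n) → i ≢ j → x ∈ Z i → y ∈ Z j → x ≢ y
       → r ≤ segLen n x y)

-- Nontrivial: a system of distinct representatives exists.
HasSDR : (n p : ℕ) → (Fin p → Subset n) → Set
HasSDR n p Z = Σ (Fin p → Fin n) λ f → Injective _≡_ _≡_ f × (∀ i → f i ∈ Z i)

-- Cut the cycle open at the representative z₃ of Z₃ and read every vertex as its distance
-- from z₃ along the orientation. The vertices of Z₁ ∪ Z₂ other than z₃ then lie at positions
-- in [r, n - r], any two of them are at least 2 apart, and at least r apart when one is in
-- Z₁ and the other in Z₂ (a cross pair). The representatives z₁ ≠ z₂ form a cross pair, which
-- gives (b3) as r + r + r ≤ n. For (b1) and (b2), scan the positions from left to right and
-- charge 2 w(q) to the gap in front of each point q, where w(q) = [q ∈ Z₁] + [q ∈ Z₂] (a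
-- cross gap can pay for a point in both sets because r ≥ 4) or w(q) = [q ∈ Z₁]. Besides
-- these charges the gap after z₃, the first cross gap and the gap back to z₃ are each at
-- least r, which yields n ≥ 3r + 2 Σ w up to a bounded slack.

module Submission where

open import Defs
open import Data.Nat using (ℕ; _≤_; _+_; _*_; _∸_)
open import Data.Fin using (Fin; zero; suc)
open import Data.Fin.Subset using (Subset; ∣_∣)
open import Data.Product using (_×_)
open import Relation.Binary.PropositionalEquality using (_≡_)

open import Data.Nat using (zero; suc; _<_; _≤ᵇ_; z≤n; s≤s; s≤s⁻¹; _<?_; _≤?_)
open import Data.Nat.Properties
open import Data.Nat.Tactic.RingSolver using (solve)
open import Algebra.Properties.CommutativeSemigroup +-commutativeSemigroup using (interchange; xy∙z≈xz∙y)
open import Data.Bool using (Bool; true; false; T)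
open import Data.Fin as Fin using (toℕ; fromℕ<)
open import Data.Fin.Properties using (toℕ-injective; toℕ-fromℕ<; toℕ<n)
open import Data.Fin.Subset using (_∈_; inside; outside)
open import Data.Vec using ([]; _∷_; here; there)
open import Data.List using () renaming ([] to []ₗ; _∷_ to _∷ₗ_)
open import Data.Product using (Σ; _,_; proj₁; proj₂; ∃-syntax)
open import Data.Sum using (_⊎_; inj₁; inj₂; [_,_])
open import Data.Empty using (⊥-elim)
open import Function using (_∘_)
open import Function.Definitions using (Injective)
open import Relation.Nullary using (¬_; Dec; yes; no; contradiction)
open import Relation.Nullary.Reflects using (ofʸ; ofⁿ)
open import Relation.Nullary.Decidable using (T?; _⊎-dec_; _×-dec_)
open import Relation.Binary using (tri<; tri≈; tri>)
open import Relation.Binary.PropositionalEquality using (refl; sym; trans; cong; cong₂; subst; _≢_; module ≡-Reasoning)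

indicator : Bool → ℕ
indicator true  = 1
indicator false = 0

indicator≤1 : ∀ b → indicator b ≤ 1
indicator≤1 true  = ≤-refl
indicator≤1 false = z≤n

indicator-off : ∀ {b} → ¬ T b → indicator b ≡ 0
indicator-off {true}  ¬t = contradiction _ ¬t
indicator-off {false} _  = refl

sumBelow : (ℕ → ℕ) → ℕ → ℕ
sumBelow f zero    = 0
sumBelow f (suc k) = sumBelow f k + f k

sumBelow-cong : ∀ {f g} k → (∀ {i} → i < k → f i ≡ g i) → sumBelow f k ≡ sumBelow g k
sumBelow-cong zero    eq = refl
sumBelow-cong (suc k) eq = cong₂ _+_ (sumBelow-cong k (eq ∘ m<n⇒m<1+n)) (eq ≤-refl)

sumBelow-+ : ∀ f j k → sumBelow f (j + k) ≡ sumBelow f j + sumBelow (λ i → f (j + i)) k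
sumBelow-+ f j zero    = trans (cong (sumBelow f) (+-identityʳ j)) (sym (+-identityʳ _))
sumBelow-+ f j (suc k) = begin
  sumBelow f (j + suc k)                                ≡⟨ cong (sumBelow f) (+-suc j k) ⟩
  sumBelow f (j + k) + f (j + k)                        ≡⟨ cong (_+ f (j + k)) (sumBelow-+ f j k) ⟩
  sumBelow f j + sumBelow g k + f (j + k)               ≡⟨ +-assoc (sumBelow f j) _ _ ⟩
  sumBelow f j + sumBelow g (suc k)                     ∎
  where
  open ≡-Reasoning
  g : ℕ → ℕ
  g i = f (j + i)

sumBelow-distrib : ∀ f g k → sumBelow (λ i → f i + g i) k ≡ sumBelow f k + sumBelow g k
sumBelow-distrib f g zero    = refl
sumBelow-distrib f g (suc k) = begin
  sumBelow h k + (f k + g k)                            ≡⟨ cong (_+ (f k + g k)) (sumBelow-distrib f g k) ⟩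
  sumBelow f k + sumBelow g k + (f k + g k)             ≡⟨ interchange (sumBelow f k) (sumBelow g k) (f k) (g k) ⟩
  sumBelow f k + f k + (sumBelow g k + g k)             ∎
  where
  open ≡-Reasoning
  h : ℕ → ℕ
  h i = f i + g i

member : ∀ {n} → Subset n → ℕ → Bool
member []      _       = false
member (b ∷ v) zero    = b
member (b ∷ v) (suc i) = member v i

member⇒∈ : ∀ {n} (v : Subset n) (x : Fin n) → T (member v (toℕ x)) → x ∈ v
member⇒∈ (inside ∷ v) zero    _ = here
member⇒∈ (b ∷ v)      (suc x) t = there (member⇒∈ v x t)

∈⇒member : ∀ {n} (v : Subset n) (x : Fin n) → x ∈ v → T (member v (toℕ x))
∈⇒member (b ∷ v) zero    here      = _
∈⇒member (b ∷ v) (suc x) (there m) = ∈⇒member v x m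

∣∣≡sumBelow : ∀ {n} (v : Subset n) → ∣ v ∣ ≡ sumBelow (indicator ∘ member v) n
∣∣≡sumBelow []            = refl
∣∣≡sumBelow {suc n} (b ∷ v) = begin
  ∣ b ∷ v ∣                                             ≡⟨ head b ⟩
  indicator b + sumBelow (indicator ∘ member v) n        ≡⟨ sumBelow-+ (indicator ∘ member (b ∷ v)) 1 n ⟨
  sumBelow (indicator ∘ member (b ∷ v)) (suc n)          ∎
  where
  open ≡-Reasoning
  head : ∀ b → ∣ b ∷ v ∣ ≡ indicator b + sumBelow (indicator ∘ member v) n
  head inside  = cong suc (∣∣≡sumBelow v)
  head outside = ∣∣≡sumBelow v

segLen-wrap : ∀ {n} (x y : Fin n) {d} → d < n
            → toℕ x + d ≡ toℕ y ⊎ toℕ x + d ≡ toℕ y + n → segLen n x y ≡ d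
segLen-wrap {n} x y {d} d<n e with toℕ x ≤ᵇ toℕ y | ≤ᵇ-reflects-≤ (toℕ x) (toℕ y) | e
... | true  | ofʸ x≤y | inj₁ e₁ = trans (cong (_∸ toℕ x) (sym e₁)) (m+n∸m≡n (toℕ x) d)
... | true  | ofʸ x≤y | inj₂ e₂ =
  contradiction (subst (_< toℕ y + n) e₂ (+-mono-≤-< x≤y d<n)) (<-irrefl refl)
... | false | ofⁿ x≰y | inj₁ e₁ = contradiction (subst (toℕ x ≤_) e₁ (m≤m+n (toℕ x) d)) x≰y
... | false | ofⁿ x≰y | inj₂ e₂ = begin
  n ∸ (toℕ x ∸ toℕ y)                                   ≡⟨ cong (_∸ (toℕ x ∸ toℕ y)) n≡d+[x∸y] ⟩
  d + (toℕ x ∸ toℕ y) ∸ (toℕ x ∸ toℕ y)                 ≡⟨ m+n∸n≡m d (toℕ x ∸ toℕ y) ⟩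
  d                                                     ∎
  where
  open ≡-Reasoning
  n≡d+[x∸y] : n ≡ d + (toℕ x ∸ toℕ y)
  n≡d+[x∸y] = +-cancelʳ-≡ (toℕ y) n _ (begin
    n + toℕ y                        ≡⟨ +-comm n (toℕ y) ⟩
    toℕ y + n                        ≡⟨ e₂ ⟨
    toℕ x + d                        ≡⟨ +-comm (toℕ x) d ⟩
    d + toℕ x                        ≡⟨ cong (d +_) (m∸n+n≡m (<⇒≤ (≰⇒> x≰y))) ⟨
    d + (toℕ x ∸ toℕ y + toℕ y)      ≡⟨ +-assoc d _ (toℕ y) ⟨
    d + (toℕ x ∸ toℕ y) + toℕ y      ∎)

segLen-self : ∀ {n} (x : Fin n) → segLen n x x ≡ 0
segLen-self x = segLen-wrap x x (≤-<-trans z≤n (toℕ<n x)) (inj₁ (+-identityʳ (toℕ x)))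

segLen>0⇒≢ : ∀ {n} {x y : Fin n} → 0 < segLen n x y → x ≢ y
segLen>0⇒≢ {x = x} pos refl = <⇒≢ pos (sym (segLen-self x))

module Rotation (n c : ℕ) (c<n : c < n) where

  Wraps : ℕ → ℕ → Set
  Wraps a y = a ≡ y ⊎ a ≡ y + n

  wraps-unique : ∀ {a y z} → y < n → z < n → Wraps a y → Wraps a z → y ≡ z
  wraps-unique y<n z<n (inj₁ refl) (inj₁ e) = e
  wraps-unique y<n z<n (inj₂ e₁) (inj₂ e₂) = +-cancelʳ-≡ n _ _ (trans (sym e₁) e₂)
  wraps-unique y<n z<n (inj₁ refl) (inj₂ e) = contradiction (subst (_< n) e y<n) (m+n≮n _ n)
  wraps-unique y<n z<n (inj₂ e) (inj₁ refl) = contradiction (subst (_< n) e z<n) (m+n≮n _ n)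

  rotate : ℕ → ℕ
  rotate p with c + p <? n
  ... | yes _ = c + p
  ... | no  _ = c + p ∸ n

  rotate-cases : ∀ p → (c + p < n × rotate p ≡ c + p) ⊎ (n ≤ c + p × rotate p + n ≡ c + p)
  rotate-cases p with c + p <? n
  ... | yes h = inj₁ (h , refl)
  ... | no  h = inj₂ (≮⇒≥ h , m∸n+n≡m (≮⇒≥ h))

  rotate-wraps : ∀ p → Wraps (c + p) (rotate p)
  rotate-wraps p with rotate-cases p
  ... | inj₁ (_ , e) = inj₁ (sym e)
  ... | inj₂ (_ , e) = inj₂ (sym e)

  rotate<n : ∀ {p} → p < n → rotate p < n
  rotate<n {p} p<n with rotate-cases p
  ... | inj₁ (h , e) = subst (_< n) (sym e) h
  ... | inj₂ (_ , e) = +-cancelʳ-< n (rotate p) n (subst (_< n + n) (sym e) (+-mono-<-≤ c<n (<⇒≤ p<n)))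

  vertex : ∀ p → p < n → Fin n
  vertex p p<n = fromℕ< (rotate<n p<n)

  vertex-wraps : ∀ {p} (p<n : p < n) → Wraps (c + p) (toℕ (vertex p p<n))
  vertex-wraps {p} p<n = subst (Wraps (c + p)) (sym (toℕ-fromℕ< (rotate<n p<n))) (rotate-wraps p)

  toℕ-vertex-0 : (0<n : 0 < n) → toℕ (vertex 0 0<n) ≡ c
  toℕ-vertex-0 0<n = wraps-unique (toℕ<n (vertex 0 0<n)) c<n (vertex-wraps 0<n) (inj₁ (+-identityʳ c))

  wraps⇒vertex≡ : ∀ {p} (p<n : p < n) {x : Fin n} → Wraps (c + p) (toℕ x) → vertex p p<n ≡ x
  wraps⇒vertex≡ p<n {x} w = toℕ-injective (wraps-unique (toℕ<n _) (toℕ<n x) (vertex-wraps p<n) w)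

  vertex-onto : ∀ (x : Fin n) → ∃[ p ] Σ (p < n) λ p<n → vertex p p<n ≡ x
  vertex-onto x with c ≤? toℕ x
  ... | yes c≤x = toℕ x ∸ c , p<n , wraps⇒vertex≡ p<n (inj₁ (m+[n∸m]≡n c≤x))
    where
    p<n : toℕ x ∸ c < n
    p<n = ≤-<-trans (m∸n≤m (toℕ x) c) (toℕ<n x)
  ... | no  c≰x = toℕ x + n ∸ c , p<n , wraps⇒vertex≡ p<n (inj₂ (m+[n∸m]≡n c≤x+n))
    where
    c≤x+n : c ≤ toℕ x + n
    c≤x+n = ≤-trans (<⇒≤ c<n) (m≤n+m n (toℕ x))
    p<n : toℕ x + n ∸ c < n
    p<n = +-cancelˡ-< c _ n (subst (_< c + n) (sym (m+[n∸m]≡n c≤x+n)) (+-monoˡ-< n (≰⇒> c≰x)))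

  segLen-vertices : ∀ {p q} (p<n : p < n) (q<n : q < n) → p < q
                  → segLen n (vertex p p<n) (vertex q q<n) ≡ q ∸ p
  segLen-vertices {p} {q} p<n q<n p<q =
    segLen-wrap _ _ (≤-<-trans (m∸n≤m q p) q<n) (shift (toℕ<n _) (vertex-wraps p<n) (vertex-wraps q<n))
    where
    d : ℕ
    d = q ∸ p
    c+p+d : c + p + d ≡ c + q
    c+p+d = trans (+-assoc c p d) (cong (c +_) (m+[n∸m]≡n (<⇒≤ p<q)))
    shift : ∀ {x y} → y < n → Wraps (c + p) x → Wraps (c + q) y → Wraps (x + d) y
    shift _ (inj₁ refl) (inj₁ e) = inj₁ (trans c+p+d e)
    shift _ (inj₁ refl) (inj₂ e) = inj₂ (trans c+p+d e)
    shift {x} {y} _ (inj₂ e₁) (inj₂ e₂) = inj₁ (+-cancelʳ-≡ n _ _ (begin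
      x + d + n    ≡⟨ xy∙z≈xz∙y x d n ⟩
      x + n + d    ≡⟨ cong (_+ d) e₁ ⟨
      c + p + d    ≡⟨ c+p+d ⟩
      c + q        ≡⟨ e₂ ⟩
      y + n        ∎))
      where open ≡-Reasoning
    shift {x} {y} y<n (inj₂ e₁) (inj₁ e₂) = contradiction y<n (≤⇒≯ (<⇒≤ (begin-strict
      n            ≤⟨ m≤n+m n x ⟩
      x + n        ≡⟨ e₁ ⟨
      c + p        <⟨ +-monoʳ-< c p<q ⟩
      c + q        ≡⟨ e₂ ⟩
      y            ∎)))
      where open ≤-Reasoning

  segLen-from-centre : ∀ {z : Fin n} → toℕ z ≡ c → ∀ {p} (p<n : p < n) → segLen n z (vertex p p<n) ≡ p
  segLen-from-centre {z} refl {p} p<n = segLen-wrap z _ p<n (vertex-wraps p<n)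

  segLen-to-centre : ∀ {z : Fin n} → toℕ z ≡ c → ∀ {p} (p<n : p < n) → 0 < p
                   → segLen n (vertex p p<n) z ≡ n ∸ p
  segLen-to-centre {z} refl {p} p<n 0<p =
    segLen-wrap _ z (∸-monoʳ-< 0<p (<⇒≤ p<n)) (back (vertex-wraps p<n))
    where
    open ≡-Reasoning
    back : ∀ {x} → Wraps (c + p) x → Wraps (x + (n ∸ p)) c
    back (inj₁ refl) = inj₂ (trans (+-assoc c p (n ∸ p)) (cong (c +_) (m+[n∸m]≡n (<⇒≤ p<n))))
    back {x} (inj₂ e) = inj₁ (+-cancelʳ-≡ p _ _ (begin
      x + (n ∸ p) + p    ≡⟨ +-assoc x (n ∸ p) p ⟩
      x + (n ∸ p + p)    ≡⟨ cong (x +_) (m∸n+n≡m (<⇒≤ p<n)) ⟩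
      x + n              ≡⟨ e ⟨
      c + p              ∎))

  sumBelow-rotate : ∀ f → sumBelow (f ∘ rotate) n ≡ sumBelow f n
  sumBelow-rotate f = begin
    sumBelow (f ∘ rotate) n                              ≡⟨ cong (sumBelow (f ∘ rotate)) n∸c+c ⟨
    sumBelow (f ∘ rotate) (n ∸ c + c)                    ≡⟨ sumBelow-+ (f ∘ rotate) (n ∸ c) c ⟩
    sumBelow (f ∘ rotate) (n ∸ c) + sumBelow (λ i → f (rotate (n ∸ c + i))) c
                                                         ≡⟨ cong₂ _+_ (sumBelow-cong (n ∸ c) (cong f ∘ unwrapped))
                                                                      (sumBelow-cong c (cong f ∘ wrapped)) ⟩
    sumBelow (λ i → f (c + i)) (n ∸ c) + sumBelow f c   ≡⟨ +-comm _ (sumBelow f c) ⟩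
    sumBelow f c + sumBelow (λ i → f (c + i)) (n ∸ c)   ≡⟨ sumBelow-+ f c (n ∸ c) ⟨
    sumBelow f (c + (n ∸ c))                             ≡⟨ cong (sumBelow f) (m+[n∸m]≡n (<⇒≤ c<n)) ⟩
    sumBelow f n                                         ∎
    where
    open ≡-Reasoning
    n∸c+c : n ∸ c + c ≡ n
    n∸c+c = m∸n+n≡m (<⇒≤ c<n)
    unwrapped : ∀ {i} → i < n ∸ c → rotate i ≡ c + i
    unwrapped {i} i<n∸c with rotate-cases i
    ... | inj₁ (_ , e) = e
    ... | inj₂ (n≤c+i , _) = contradiction
      (subst (c + i <_) (m+[n∸m]≡n (<⇒≤ c<n)) (+-monoʳ-< c i<n∸c)) (≤⇒≯ n≤c+i)
    wrapped : ∀ {i} → i < c → rotate (n ∸ c + i) ≡ i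
    wrapped {i} i<c = wraps-unique (rotate<n (subst (n ∸ c + i <_) n∸c+c (+-monoʳ-< (n ∸ c) i<c))) (<-trans i<c c<n)
      (rotate-wraps (n ∸ c + i))
      (inj₂ (begin
        c + (n ∸ c + i)    ≡⟨ +-assoc c (n ∸ c) i ⟨
        c + (n ∸ c) + i    ≡⟨ cong (_+ i) (m+[n∸m]≡n (<⇒≤ c<n)) ⟩
        n + i              ≡⟨ +-comm n i ⟩
        i + n              ∎))

near-step : ∀ {x K v l q D} → x + 2 * K ≤ l + D → l + 2 * v ≤ q → x + 2 * (K + v) ≤ q + D
near-step {x} {K} {v} {l} {q} {D} h g = begin
  x + 2 * (K + v)      ≡⟨ solve (x ∷ₗ K ∷ₗ v ∷ₗ []ₗ) ⟩
  x + 2 * K + 2 * v    ≤⟨ +-monoˡ-≤ (2 * v) h ⟩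
  l + D + 2 * v        ≡⟨ xy∙z≈xz∙y l D (2 * v) ⟩
  l + 2 * v + D        ≤⟨ +-monoˡ-≤ D g ⟩
  q + D                ∎
  where open ≤-Reasoning

first-step : ∀ {r q K v ω} → r ≤ q → v ≤ ω → r + 2 * (K + v) ≤ q + (2 * ω + 2 * K)
first-step {r} {q} {K} {v} {ω} h g = begin
  r + 2 * (K + v)      ≡⟨ solve (r ∷ₗ K ∷ₗ v ∷ₗ []ₗ) ⟩
  r + (2 * v + 2 * K)  ≤⟨ +-mono-≤ h (+-monoˡ-≤ (2 * K) (*-monoʳ-≤ 2 g)) ⟩
  q + (2 * ω + 2 * K)  ∎
  where open ≤-Reasoning

cross-step : ∀ {r K v ω l q D} → r + 2 * K ≤ l + D → l + r ≤ q → v ≤ ω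
           → 2 * r + 2 * (K + v) ≤ q + (D + 2 * ω)
cross-step {r} {K} {v} {ω} {l} {q} {D} h g f = begin
  2 * r + 2 * (K + v)      ≡⟨ solve (r ∷ₗ K ∷ₗ v ∷ₗ []ₗ) ⟩
  r + (r + 2 * K) + 2 * v  ≤⟨ +-mono-≤ (+-monoʳ-≤ r h) (*-monoʳ-≤ 2 f) ⟩
  r + (l + D) + 2 * ω      ≡⟨ solve (r ∷ₗ l ∷ₗ D ∷ₗ ω ∷ₗ []ₗ) ⟩
  l + r + (D + 2 * ω)      ≤⟨ +-monoˡ-≤ (D + 2 * ω) g ⟩
  q + (D + 2 * ω)          ∎
  where open ≤-Reasoning

last-step : ∀ {r K l n D} → 2 * r + 2 * K ≤ l + D → l + r ≤ n → 3 * r + 2 * K ≤ n + D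
last-step {r} {K} {l} {n} {D} h g = begin
  3 * r + 2 * K            ≡⟨ solve (r ∷ₗ K ∷ₗ []ₗ) ⟩
  r + (2 * r + 2 * K)      ≤⟨ +-monoʳ-≤ r h ⟩
  r + (l + D)              ≡⟨ solve (r ∷ₗ l ∷ₗ D ∷ₗ []ₗ) ⟩
  l + r + D                ≤⟨ +-monoˡ-≤ D g ⟩
  n + D                    ∎
  where open ≤-Reasoning

extend-below : ∀ {P : ℕ → Set} {k} → (∀ {p} → p < k → P p) → P k → ∀ {p} → p < suc k → P p
extend-below below at p<1+k with m<1+n⇒m<n∨m≡n p<1+k
... | inj₁ p<k  = below p<k
... | inj₂ refl = at

-- Positions 0, …, n - 1 of the cycle cut open at a centre, which sits at position 0;
-- α and β mark the two colour classes, possibly at the same position.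
module SeparatedPoints (n r : ℕ) (α β : ℕ → Bool) where

  Point : ℕ → Set
  Point p = T (α p) ⊎ T (β p)

  Cross : ℕ → ℕ → Set
  Cross p q = T (α p) × T (β q) ⊎ T (β p) × T (α q)

  point? : ∀ p → Dec (Point p)
  point? p = T? (α p) ⊎-dec T? (β p)

  cross? : ∀ p q → Dec (Cross p q)
  cross? p q = (T? (α p) ×-dec T? (β q)) ⊎-dec (T? (β p) ×-dec T? (α q))

  cross-sym : ∀ {p q} → Cross p q → Cross q p
  cross-sym (inj₁ (a , b)) = inj₂ (b , a)
  cross-sym (inj₂ (b , a)) = inj₁ (a , b)

  cross-pointˡ : ∀ {p q} → Cross p q → Point p
  cross-pointˡ (inj₁ (a , _)) = inj₁ a
  cross-pointˡ (inj₂ (b , _)) = inj₂ b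

  cross-pointʳ : ∀ {p q} → Cross p q → Point q
  cross-pointʳ = cross-pointˡ ∘ cross-sym

  cross-via : ∀ {p l q} → Point l → Cross p q → Cross p l ⊎ Cross l q
  cross-via (inj₁ al) (inj₁ (ap , bq)) = inj₂ (inj₁ (al , bq))
  cross-via (inj₂ bl) (inj₁ (ap , bq)) = inj₁ (inj₁ (ap , bl))
  cross-via (inj₁ al) (inj₂ (bp , aq)) = inj₁ (inj₂ (bp , al))
  cross-via (inj₂ bl) (inj₂ (bp , aq)) = inj₂ (inj₂ (bl , aq))

  record Separated : Set where
    field
      spread    : ∀ {p q} → 0 < p → p < q → q < n → Point p → Point q → p + 2 ≤ q
      cross-far : ∀ {p q} → 0 < p → p < q → q < n → Cross p q → p + r ≤ q
      centre-far : ∀ {p} → 0 < p → p < n → Point p → r ≤ p × p + r ≤ n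

  record CrossPair : Set where
    field
      p q   : ℕ
      0<p   : 0 < p
      p<q   : p < q
      q<n   : q < n
      cross : Cross p q

  crossPair : ∀ {p q} → 0 < p → p < n → 0 < q → q < n → p ≢ q → T (α p) → T (β q) → CrossPair
  crossPair {p} {q} 0<p p<n 0<q q<n p≢q ap bq with <-cmp p q
  ... | tri< p<q _ _ = record { 0<p = 0<p ; p<q = p<q ; q<n = q<n ; cross = inj₁ (ap , bq) }
  ... | tri≈ _ p≡q _ = contradiction p≡q p≢q
  ... | tri> _ _ q<p = record { 0<p = 0<q ; p<q = q<p ; q<n = p<n ; cross = inj₂ (bq , ap) }

  three-arcs : Separated → CrossPair → 3 * r ≤ n
  three-arcs sep cp = begin
    3 * r          ≡⟨ solve (r ∷ₗ []ₗ) ⟩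
    r + r + r      ≤⟨ +-monoˡ-≤ r (+-monoˡ-≤ r (proj₁ (centre-far 0<p (<-trans p<q q<n) (cross-pointˡ cross)))) ⟩
    p + r + r      ≤⟨ +-monoˡ-≤ r (cross-far 0<p p<q q<n cross) ⟩
    q + r          ≤⟨ proj₂ (centre-far (<-trans 0<p p<q) q<n (cross-pointʳ cross)) ⟩
    n              ∎
    where
    open Separated sep
    open CrossPair cp
    open ≤-Reasoning

  module WeightedScan (sep : Separated) (ω : ℕ) (w : ℕ → ℕ)
                  (w≤ω : ∀ p → w p ≤ ω)
                  (w-off : ∀ p → ¬ Point p → w p ≡ 0)
                  (w-spread : ∀ {p q} → 0 < p → p < q → q < n → Point p → Point q → p + 2 * w q ≤ q)
                  where

    open Separated sep

    W : ℕ → ℕ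
    W = sumBelow w

    -- 2 * w 0 pays for the centre, and each 2 * ω for a point whose preceding gap is
    -- charged r instead of 2 * w: the first point, and the point after the first cross gap.
    slack : ℕ
    slack = 2 * ω + 2 * w 0

    data Scan (k : ℕ) : Set where
      empty     : (∀ {p} → p < k → 0 < p → ¬ Point p) → W k ≡ w 0 → Scan k
      uncrossed : ∀ {l} → 0 < l → l < k → Point l
                → (∀ {p} → p < k → l < p → ¬ Point p)
                → (∀ {q} → q < k → ∀ {p} → 0 < p → p < q → ¬ Cross p q)
                → r + 2 * W k ≤ l + slack → Scan k
      crossed   : ∀ {l} → 0 < l → l < k → Point l
                → 2 * r + 2 * W k ≤ l + (slack + 2 * ω) → Scan k

    module _ {k : ℕ} (0<k : 0 < k) (k<n : k < n) where

      W-skip : ¬ Point k → W (suc k) ≡ W k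
      W-skip ¬pk = trans (cong (W k +_) (w-off k ¬pk)) (+-identityʳ (W k))

      skip : ¬ Point k → Scan k → Scan (suc k)
      skip ¬pk (empty none e) =
        empty (extend-below none (λ _ → ¬pk)) (trans (W-skip ¬pk) e)
      skip ¬pk (uncrossed {l} 0<l l<k pl last noCross h) =
        uncrossed 0<l (m<n⇒m<1+n l<k) pl (extend-below last (λ _ → ¬pk))
          (extend-below noCross (λ _ _ → ¬pk ∘ cross-pointʳ))
          (subst (λ z → r + 2 * z ≤ l + slack) (sym (W-skip ¬pk)) h)
      skip ¬pk (crossed {l} 0<l l<k pl h) =
        crossed 0<l (m<n⇒m<1+n l<k) pl
          (subst (λ z → 2 * r + 2 * z ≤ l + (slack + 2 * ω)) (sym (W-skip ¬pk)) h)

      nothing-after : ∀ {p} → p < suc k → k < p → ¬ Point p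
      nothing-after p<1+k k<p _ = ≤⇒≯ (s≤s⁻¹ p<1+k) k<p

      visit : Point k → Scan k → Scan (suc k)
      visit pk (empty none e) =
        uncrossed 0<k ≤-refl pk nothing-after noCross
          (subst (λ z → r + 2 * (z + w k) ≤ k + slack) (sym e)
            (first-step {K = w 0} (proj₁ (centre-far 0<k k<n pk)) (w≤ω k)))
        where
        noCross : ∀ {q} → q < suc k → ∀ {p} → 0 < p → p < q → ¬ Cross p q
        noCross q<1+k 0<p p<q c = none (<-≤-trans p<q (s≤s⁻¹ q<1+k)) 0<p (cross-pointˡ c)
      visit pk (uncrossed {l} 0<l l<k pl last noCross h) with cross? l k
      ... | yes c = crossed 0<k ≤-refl pk (cross-step {K = W k} {l = l} {D = slack} h (cross-far 0<l l<k k<n c) (w≤ω k))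
      ... | no ¬c = uncrossed 0<k ≤-refl pk nothing-after (extend-below noCross noCross-k)
                      (near-step {x = r} {K = W k} {l = l} {D = slack} h (w-spread 0<l l<k k<n pl pk))
        where
        noCross-k : ∀ {p} → 0 < p → p < k → ¬ Cross p k
        noCross-k {p} 0<p p<k c with <-cmp p l
        ... | tri< p<l _ _  = [ noCross l<k 0<p p<l , ¬c ] (cross-via pl c)
        ... | tri≈ _ refl _ = ¬c c
        ... | tri> _ _ l<p  = last p<k l<p (cross-pointˡ c)
      visit pk (crossed {l} 0<l l<k pl h) =
        crossed 0<k ≤-refl pk
          (near-step {x = 2 * r} {K = W k} {l = l} {D = slack + 2 * ω} h (w-spread 0<l l<k k<n pl pk))

    step : ∀ {k} → 0 < k → k < n → Scan k → Scan (suc k)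
    step {k} 0<k k<n with point? k
    ... | yes pk  = visit 0<k k<n pk
    ... | no  ¬pk = skip 0<k k<n ¬pk

    scan : ∀ {k} → 0 < k → k ≤ n → Scan k
    scan {suc zero}    _ _     = empty (λ p<1 0<p _ → ≤⇒≯ (s≤s⁻¹ p<1) 0<p) refl
    scan {suc (suc k)} _ k+2≤n = step (s≤s z≤n) k+2≤n (scan (s≤s z≤n) (<⇒≤ k+2≤n))

    weighted-bound : CrossPair → 3 * r + 2 * W n ≤ n + (slack + 2 * ω)
    weighted-bound cp = at-end (scan (<-trans 0<p (<-trans p<q q<n)) ≤-refl)
      where
      open CrossPair cp
      at-end : Scan n → 3 * r + 2 * W n ≤ n + (slack + 2 * ω)
      at-end (empty none _)                = ⊥-elim (none (<-trans p<q q<n) 0<p (cross-pointˡ cross))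
      at-end (uncrossed _ _ _ _ noCross _) = ⊥-elim (noCross q<n 0<p p<q cross)
      at-end (crossed {l} 0<l l<n pl h)    = last-step {K = W n} {l = l} h (proj₂ (centre-far 0<l l<n pl))

  colours : ℕ → ℕ
  colours p = indicator (α p) + indicator (β p)

  colours≤2 : ∀ p → colours p ≤ 2
  colours≤2 p = +-mono-≤ (indicator≤1 (α p)) (indicator≤1 (β p))

  colours-off : ∀ p → ¬ Point p → colours p ≡ 0
  colours-off p ¬pp with α p | β p
  ... | true  | _     = contradiction (inj₁ _) ¬pp
  ... | false | true  = contradiction (inj₂ _) ¬pp
  ... | false | false = refl

  uncrossed-single : ∀ {p q} → Point p → ¬ Cross p q → colours q ≤ 1
  uncrossed-single {p} {q} pp ¬c with α q | β q
  ... | false | _     = indicator≤1 _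
  ... | true  | false = ≤-refl
  ... | true  | true  = ⊥-elim ([ (λ ap → ¬c (inj₁ (ap , _))) , (λ bp → ¬c (inj₂ (bp , _))) ] pp)

  both-colours-bound : Separated → 4 ≤ r → CrossPair
                     → 3 * r + 2 * sumBelow colours n ≤ n + (2 * 2 + 2 * colours 0 + 2 * 2)
  both-colours-bound sep 4≤r = weighted-bound
    where
    open Separated sep
    spread-colours : ∀ {p q} → 0 < p → p < q → q < n → Point p → Point q → p + 2 * colours q ≤ q
    spread-colours {p} {q} 0<p p<q q<n pp pq with cross? p q
    ... | yes c = ≤-trans (+-monoʳ-≤ p (≤-trans (*-monoʳ-≤ 2 (colours≤2 q)) 4≤r)) (cross-far 0<p p<q q<n c)
    ... | no ¬c = ≤-trans (+-monoʳ-≤ p (*-monoʳ-≤ 2 (uncrossed-single pp ¬c))) (spread 0<p p<q q<n pp pq)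
    open WeightedScan sep 2 colours colours≤2 colours-off spread-colours

  first-colour-bound : Separated → CrossPair
                     → 3 * r + 2 * sumBelow (indicator ∘ α) n ≤ n + (2 * 1 + 2 * indicator (α 0) + 2 * 1)
  first-colour-bound sep = weighted-bound
    where
    open Separated sep
    spread-α : ∀ {p q} → 0 < p → p < q → q < n → Point p → Point q → p + 2 * indicator (α q) ≤ q
    spread-α {p} {q} 0<p p<q q<n pp pq =
      ≤-trans (+-monoʳ-≤ p (*-monoʳ-≤ 2 (indicator≤1 (α q)))) (spread 0<p p<q q<n pp pq)
    open WeightedScan sep 1 (indicator ∘ α) (indicator≤1 ∘ α) (λ p ¬pp → indicator-off (¬pp ∘ inj₁)) spread-α

≤∸⇒+≤ : ∀ {p q d} → p ≤ q → d ≤ q ∸ p → p + d ≤ q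
≤∸⇒+≤ {p} {q} {d} p≤q h = subst (_≤ q) (+-comm d p) (m≤o∸n⇒m+n≤o d p≤q h)

module Linearisation {n r : ℕ} (2≤r : 2 ≤ r) (Z : Fin 3 → Subset n)
                     (scheme : IsScheme n r 3 Z) (sdr : HasSDR n 3 Z) where

  private
    same : ∀ i (x y : Fin n) → x ∈ Z i → y ∈ Z i → x ≢ y → 2 ≤ segLen n x y
    same = proj₁ scheme

    apart : ∀ i j (x y : Fin n) → i ≢ j → x ∈ Z i → y ∈ Z j → x ≢ y → r ≤ segLen n x y
    apart = proj₂ scheme

    f : Fin 3 → Fin n
    f = proj₁ sdr

    f-injective : Injective _≡_ _≡_ f
    f-injective = proj₁ (proj₂ sdr)

    f∈Z : ∀ i → f i ∈ Z i
    f∈Z = proj₂ (proj₂ sdr)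

    z : Fin n
    z = f (suc (suc zero))

  open Rotation n (toℕ z) (toℕ<n z)

  α β : ℕ → Bool
  α p = member (Z zero) (rotate p)
  β p = member (Z (suc zero)) (rotate p)

  open SeparatedPoints n r α β public

  ∣Z∣≡sumBelow : ∀ i → ∣ Z i ∣ ≡ sumBelow (indicator ∘ member (Z i) ∘ rotate) n
  ∣Z∣≡sumBelow i = trans (∣∣≡sumBelow (Z i)) (sym (sumBelow-rotate (indicator ∘ member (Z i))))

  ∣Z₁∣+∣Z₂∣≡sumBelow : ∣ Z zero ∣ + ∣ Z (suc zero) ∣ ≡ sumBelow colours n
  ∣Z₁∣+∣Z₂∣≡sumBelow = trans (cong₂ _+_ (∣Z∣≡sumBelow zero) (∣Z∣≡sumBelow (suc zero)))
                             (sym (sumBelow-distrib (indicator ∘ α) (indicator ∘ β) n))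

  vertex-∈ : ∀ i {p} (p<n : p < n) → T (member (Z i) (rotate p)) → vertex p p<n ∈ Z i
  vertex-∈ i p<n t = member⇒∈ (Z i) _ (subst (T ∘ member (Z i)) (sym (toℕ-fromℕ< (rotate<n p<n))) t)

  ∈-vertex : ∀ i {p} (p<n : p < n) → vertex p p<n ∈ Z i → T (member (Z i) (rotate p))
  ∈-vertex i p<n m = subst (T ∘ member (Z i)) (toℕ-fromℕ< (rotate<n p<n)) (∈⇒member (Z i) _ m)

  point-colour : ∀ {p} (p<n : p < n) → Point p → ∃[ i ] i ≢ suc (suc zero) × vertex p p<n ∈ Z i
  point-colour p<n (inj₁ a) = zero , (λ ()) , vertex-∈ zero p<n a
  point-colour p<n (inj₂ b) = suc zero , (λ ()) , vertex-∈ (suc zero) p<n b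

  vertices-≢ : ∀ {p q} (p<n : p < n) (q<n : q < n) → p < q → vertex p p<n ≢ vertex q q<n
  vertices-≢ p<n q<n p<q =
    segLen>0⇒≢ (subst (0 <_) (sym (segLen-vertices p<n q<n p<q)) (m<n⇒0<n∸m p<q))

  centre-≢ : ∀ {p} (p<n : p < n) → 0 < p → z ≢ vertex p p<n
  centre-≢ p<n 0<p = segLen>0⇒≢ (subst (0 <_) (sym (segLen-from-centre refl p<n)) 0<p)

  segLen-gap : ∀ {p q d} (p<n : p < n) (q<n : q < n) → p < q
             → d ≤ segLen n (vertex p p<n) (vertex q q<n) → p + d ≤ q
  segLen-gap p<n q<n p<q h = ≤∸⇒+≤ (<⇒≤ p<q) (subst (_ ≤_) (segLen-vertices p<n q<n p<q) h)

  two-apart : ∀ i j {x y} → x ∈ Z i → y ∈ Z j → x ≢ y → 2 ≤ segLen n x y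
  two-apart i j x∈ y∈ x≢y with i Fin.≟ j
  ... | yes refl = same i _ _ x∈ y∈ x≢y
  ... | no  i≢j  = ≤-trans 2≤r (apart i j _ _ i≢j x∈ y∈ x≢y)

  points-apart : ∀ {p q} (p<n : p < n) (q<n : q < n) → p < q → Point p → Point q
               → 2 ≤ segLen n (vertex p p<n) (vertex q q<n)
  points-apart p<n q<n p<q pp pq with point-colour p<n pp | point-colour q<n pq
  ... | i , _ , x∈ | j , _ , y∈ = two-apart i j x∈ y∈ (vertices-≢ p<n q<n p<q)

  cross-apart : ∀ {p q} (p<n : p < n) (q<n : q < n) → p < q → Cross p q
              → r ≤ segLen n (vertex p p<n) (vertex q q<n)
  cross-apart p<n q<n p<q (inj₁ (a , b)) =
    apart zero (suc zero) _ _ (λ ()) (vertex-∈ zero p<n a) (vertex-∈ (suc zero) q<n b) (vertices-≢ p<n q<n p<q)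
  cross-apart p<n q<n p<q (inj₂ (b , a)) =
    apart (suc zero) zero _ _ (λ ()) (vertex-∈ (suc zero) p<n b) (vertex-∈ zero q<n a) (vertices-≢ p<n q<n p<q)

  centre-apart : ∀ {p} (p<n : p < n) → 0 < p → Point p
               → r ≤ segLen n z (vertex p p<n) × r ≤ segLen n (vertex p p<n) z
  centre-apart p<n 0<p pp with point-colour p<n pp
  ... | i , i≢3 , x∈ = apart (suc (suc zero)) i _ _ (i≢3 ∘ sym) (f∈Z _) x∈ (centre-≢ p<n 0<p)
                     , apart i (suc (suc zero)) _ _ i≢3 x∈ (f∈Z _) (centre-≢ p<n 0<p ∘ sym)

  separated : Separated
  separated = record
    { spread     = λ _ p<q q<n pp pq →
        let p<n = <-trans p<q q<n in segLen-gap p<n q<n p<q (points-apart p<n q<n p<q pp pq)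
    ; cross-far  = λ _ p<q q<n c →
        let p<n = <-trans p<q q<n in segLen-gap p<n q<n p<q (cross-apart p<n q<n p<q c)
    ; centre-far = λ 0<p p<n pp →
        subst (r ≤_) (segLen-from-centre refl p<n) (proj₁ (centre-apart p<n 0<p pp)) ,
        ≤∸⇒+≤ (<⇒≤ p<n) (subst (r ≤_) (segLen-to-centre refl p<n 0<p) (proj₂ (centre-apart p<n 0<p pp)))
    }

  representative-position : ∀ i → i ≢ suc (suc zero) → ∃[ p ] 0 < p × Σ (p < n) λ p<n → vertex p p<n ≡ f i
  representative-position i i≢3 with vertex-onto (f i)
  ... | zero  , 0<n , v≡f = contradiction (f-injective (trans (sym v≡f) (toℕ-injective (toℕ-vertex-0 0<n)))) i≢3
  ... | suc p , p<n , v≡f = suc p , s≤s z≤n , p<n , v≡f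

  representatives-cross : CrossPair
  representatives-cross with representative-position zero (λ ()) | representative-position (suc zero) (λ ())
  ... | p , 0<p , p<n , vp | q , 0<q , q<n , vq =
    crossPair 0<p p<n 0<q q<n p≢q
      (∈-vertex zero p<n (subst (_∈ Z zero) (sym vp) (f∈Z zero)))
      (∈-vertex (suc zero) q<n (subst (_∈ Z (suc zero)) (sym vq) (f∈Z (suc zero))))
    where
    p≢q : p ≢ q
    p≢q refl with f-injective (trans (sym vp) (trans (cong (vertex p) (<-irrelevant p<n q<n)) vq))
    ... | ()

shift-slack : ∀ r S {n c d} → 3 * r + 2 * S ≤ n + c → c ≤ d → 2 * S + 3 * r ∸ d ≤ n
shift-slack r S {n} {c} {d} h c≤d = m≤n+o⇒m∸n≤o (2 * S + 3 * r) d (begin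
  2 * S + 3 * r    ≡⟨ +-comm (2 * S) (3 * r) ⟩
  3 * r + 2 * S    ≤⟨ h ⟩
  n + c            ≤⟨ +-monoʳ-≤ n c≤d ⟩
  n + d            ≡⟨ +-comm n d ⟩
  d + n            ∎)
  where open ≤-Reasoning

lemma2 : (n r : ℕ) → 3 ≤ n → 2 ≤ r → (Z : Fin 3 → Subset n)
    → IsScheme n r 3 Z → HasSDR n 3 Z
    → ((4 ≤ r → 6 ≤ ∣ Z zero ∣ + ∣ Z (suc zero) ∣ → ∣ Z (suc (suc zero)) ∣ ≡ 1
          → 2 * (∣ Z zero ∣ + ∣ Z (suc zero) ∣) + 3 * r ∸ 12 ≤ n)
       × (∣ Z (suc zero) ∣ ≡ 1 → ∣ Z (suc (suc zero)) ∣ ≡ 1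
          → 2 * ∣ Z zero ∣ + 3 * r ∸ 6 ≤ n)
       × (∣ Z zero ∣ ≡ 1 → ∣ Z (suc zero) ∣ ≡ 1 → ∣ Z (suc (suc zero)) ∣ ≡ 1
          → 3 * r ≤ n))
lemma2 n r _ 2≤r Z scheme sdr =
  (λ 4≤r _ _ → subst (λ s → 2 * s + 3 * r ∸ 12 ≤ n) (sym ∣Z₁∣+∣Z₂∣≡sumBelow)
     (shift-slack r (sumBelow colours n) (both-colours-bound separated 4≤r representatives-cross)
        (+-monoˡ-≤ (2 * 2) (+-monoʳ-≤ (2 * 2) (*-monoʳ-≤ 2 (colours≤2 0)))))) ,
  (λ _ _ → subst (λ s → 2 * s + 3 * r ∸ 6 ≤ n) (sym (∣Z∣≡sumBelow zero))
     (shift-slack r (sumBelow (indicator ∘ α) n) (first-colour-bound separated representatives-cross)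
        (+-monoˡ-≤ (2 * 1) (+-monoʳ-≤ (2 * 1) (*-monoʳ-≤ 2 (indicator≤1 (α 0))))))) ,
  (λ _ _ _ → three-arcs separated representatives-cross)
  where open Linearisation 2≤r Z scheme sdr
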